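{- Let $S=(W,\mathcal{R},\mathcal{O},\mathcal{D},\mathfrak{n},\|\cdot\|)$ be a Kripke model for $\mathcal{L}$ and $w\in W$, and let $S^w$ be the submodel of $S$ generated by $w$. Then (i) $(S^w,w)$ is a uniform pointed Kripke model; and (ii) for every $\varphi\in\mathsf{F}$, $S,w\models_k\varphi$ iff $S^w,w\models_k\varphi$.
   Context: Fix countable $\mathsf{At}$. The language $\mathcal{L}=(\mathsf{F},\mathsf{A})$ has formulas $\varphi::=p\mid\lnot\varphi\mid(\varphi\land\varphi)\mid\square\varphi\mid\mathsf{aware}(\alpha)\mid\mathsf{conc}(\alpha)=\varphi\mid\mathsf{strict}(\alpha)\mid\mathsf{undercuts}(\alpha,\alpha)\mid\mathsf{wellshap}(\alpha)$ and arguments $\alpha::=\langle\varphi\rangle\mid\langle\alpha_1,\dots,\alpha_n\twoheadrightarrow\varphi\rangle\mid\langle\alpha_1,\dots,\alpha_n\Rightarrow\varphi\rangle$ ($n\ge1$). $\vdash_0$ is classical propositional consequence; $\mathsf{Conc}(\alpha)$ is the final formula of $\alpha$; $\mathsf{TopRule}(\langle\alpha_1,\dots,\alpha_n\hookrightarrow\varphi\rangle)=((\mathsf{Conc}(\alpha_1),\dots,\mathsf{Conc}(\alpha_n)),\varphi)$; $\mathsf{DefRule}(\alpha)$ is the set of top rules of all $\Rightarrow$-subarguments of $\alpha$ (including $\alpha$). $\mathsf{SEQ}(\mathsf{F})$ is the set of finite sequences $((\varphi_1,\dots,\varphi_n),\varphi)$ over $\mathsf{F}$. A Kripke model for $\mathcal{L}$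 is $S=(W,\mathcal{R},\mathcal{O},\mathcal{D},\mathfrak{n},\|\cdot\|)$ with $W\ne\emptyset$; $\mathcal{R}\subseteq W\times W$ serial, transitive and euclidean; $\mathcal{O}:W\to\wp(\mathsf{A})$; $\mathcal{D}:W\to\wp(\mathsf{SEQ}(\mathsf{F}))$; $\mathfrak{n}:W\times\mathsf{SEQ}(\mathsf{F})\to\mathsf{At}$ partial; $\|\cdot\|:\mathsf{At}\to\wp(W)$; such that $w\mathcal{R}w'$ implies $\mathcal{O}(w)=\mathcal{O}(w')$, $\mathcal{D}(w)=\mathcal{D}(w')$ and $\mathfrak{n}(w,R)=\mathfrak{n}(w',R)$ for all $R$; and every $((\varphi_1,\dots,\varphi_n),\varphi)\in\mathcal{D}(w)$ satisfies $\{\varphi_1,\dots,\varphi_n,\varphi\}\nvdash_0\perp$ and $\{\varphi_1,\dots,\varphi_n\}\nvdash_0\varphi$. $WS^S(w)$ is the smallest set of arguments containing all $\langle\varphi\rangle$, containing $\langle\alpha_1,\dots,\alpha_n\twoheadrightarrow\varphi\rangle$ iff all $\alpha_i\in WS^S(w)$ and $\{\mathsf{Conc}(\alpha_i)\}_i\vdash_0\varphi$, and containing $\langle\alpha_1,\dots,\alpha_n\Rightarrow\varphi\rangle$ iff all $\alpha_i\in WS^S(w)$ and $((\mathsf{Conc}(\alpha_1),\dots,\mathsf{Conc}(\alpha_n)),\varphi)\in\mathcal{D}(w)$. Truth $\models_k$: $p$ iff $w\in\|p\|$; Booleans standard; $\square\varphi$ iff $\varphi$ holds at all $v$ with $w\mathcal{R}v$;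 $\mathsf{aware}(\alpha)$ iff $\alpha\in\mathcal{O}(w)$; $\mathsf{conc}(\alpha)=\varphi$ iff $\mathsf{Conc}(\alpha)=\varphi$; $\mathsf{strict}(\alpha)$ iff $\mathsf{DefRule}(\alpha)=\emptyset$; $\mathsf{wellshap}(\alpha)$ iff $\alpha\in WS^S(w)$; $\mathsf{undercuts}(\alpha,\beta)$ iff $\beta=\langle\beta_1,\dots,\beta_n\Rightarrow\varphi\rangle$ and $\mathsf{Conc}(\alpha)=\lnot\mathfrak{n}(w,\mathsf{TopRule}(\beta))$. $S$ is uniform iff for all $w,w'\in W$: $\mathcal{O}(w)=\mathcal{O}(w')$, $\mathcal{D}(w)=\mathcal{D}(w')$, and $\mathfrak{n}(w,R)=\mathfrak{n}(w',R)$ for every $R$ in $\mathcal{D}$. The submodel generated by $w$ is the restriction of $S$ (of $\mathcal{R}$, $\mathcal{O}$, $\mathcal{D}$, $\mathfrak{n}$, $\|\cdot\|$) to the smallest set of worlds containing $w$ and closed under $\mathcal{R}$-successors. -}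

module Defs where

open import Data.Nat using (ℕ)
open import Data.Bool using (Bool; true; false; not; _∧_)
open import Data.List using (List; []; _∷_; map)
open import Data.List.Relation.Unary.All using (All)
open import Data.List.Relation.Unary.Any using (Any)
open import Data.Maybe using (Maybe; just; nothing)
open import Data.Product using (Σ; _×_; _,_; ∃)
open import Data.Empty using (⊥)
open import Relation.Nullary using (¬_)
open import Relation.Binary.PropositionalEquality using (_≡_)
open import Function.Bundles using (_⇔_)
open import Relation.Binary.Construct.Closure.ReflexiveTransitive using (Star)

At : Set
At = ℕ

-- Formulas F and arguments A (mutually inductive).
-- Arguments with n ≥ 1 immediate subarguments are given as a first
-- subargument plus a list of the remaining ones.
mutual
  data Form : Set where
    atom     : At → Form
    neg      : Form → Form
    and      : Form → Form → Form
    box      : Form → Form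
    aware    : Arg → Form
    conc=    : Arg → Form → Form
    strictF  : Arg → Form
    undercuts : Arg → Arg → Form
    wellshap : Arg → Form

  data Arg : Set where
    leaf : Form → Arg
    sarg : Arg → List Arg → Form → Arg    -- ⟨α₁,…,αₙ ↠ φ⟩  (strict rule)
    darg : Arg → List Arg → Form → Arg    -- ⟨α₁,…,αₙ ⇒ φ⟩  (defeasible rule)

SEQ : Set
SEQ = List Form × Form

Conc : Arg → Form
Conc (leaf φ) = φ
Conc (sarg _ _ φ) = φ
Conc (darg _ _ φ) = φ

TopRule : Arg → List Arg → Form → SEQ
TopRule α αs φ = (map Conc (α ∷ αs) , φ)

data InDefRule (R : SEQ) : Arg → Set where
  here-d  : ∀ {α αs φ} → R ≡ TopRule α αs φ → InDefRule R (darg α αs φ)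
  there-d : ∀ {α αs φ} → Any (InDefRule R) (α ∷ αs) → InDefRule R (darg α αs φ)
  there-s : ∀ {α αs φ} → Any (InDefRule R) (α ∷ αs) → InDefRule R (sarg α αs φ)

-- Classical propositional consequence ⊢₀: formulas whose main connective
-- is not ¬ or ∧ are treated as propositional atoms.
eval : (Form → Bool) → Form → Bool
eval v (neg φ) = not (eval v φ)
eval v (and φ ψ) = eval v φ ∧ eval v ψ
eval v φ = v φ

_⊢₀_ : List Form → Form → Set
Γ ⊢₀ φ = ∀ (v : Form → Bool) → All (λ ψ → eval v ψ ≡ true) Γ → eval v φ ≡ true

falsum : Form
falsum = and (atom 0) (neg (atom 0))

record Model : Set₁ where
  field
    W    : Set
    w₀   : W                              -- witness of W ≠ ∅
    Rel  : W → W → Set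
    O    : W → Arg → Set
    D    : W → SEQ → Set
    nm   : W → SEQ → Maybe At
    val  : At → W → Set

_≐_ : {A : Set} → (A → Set) → (A → Set) → Set
P ≐ Q = ∀ a → P a ⇔ Q a

record IsKripke (S : Model) : Set where
  open Model S
  field
    serial    : ∀ w → ∃ λ v → Rel w v
    trans     : ∀ {u v w} → Rel u v → Rel v w → Rel u w
    eucl      : ∀ {u v w} → Rel u v → Rel u w → Rel v w
    O-inv     : ∀ {w w'} → Rel w w' → O w ≐ O w'
    D-inv     : ∀ {w w'} → Rel w w' → D w ≐ D w'
    n-inv     : ∀ {w w'} → Rel w w' → ∀ R → nm w R ≡ nm w' R
    D-cons    : ∀ w φs φ → D w (φs , φ) → ¬ ((φ ∷ φs) ⊢₀ falsum)
    D-nonded  : ∀ w φs φ → D w (φs , φ) → ¬ (φs ⊢₀ φ)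

record Uniform (S : Model) : Set where
  open Model S
  field
    O-unif : ∀ w w' → O w ≐ O w'
    D-unif : ∀ w w' → D w ≐ D w'
    n-unif : ∀ w w' R → D w R → nm w R ≡ nm w' R

data WS (S : Model) (w : Model.W S) : Arg → Set where
  ws-leaf : ∀ φ → WS S w (leaf φ)
  ws-sarg : ∀ α αs φ → All (WS S w) (α ∷ αs) → map Conc (α ∷ αs) ⊢₀ φ
          → WS S w (sarg α αs φ)
  ws-darg : ∀ α αs φ → All (WS S w) (α ∷ αs) → Model.D S w (TopRule α αs φ)
          → WS S w (darg α αs φ)

Undercuts : (S : Model) → Model.W S → Arg → Arg → Set
Undercuts S w α (darg β βs φ) with Model.nm S w (TopRule β βs φ)
... | just p  = Conc α ≡ neg (atom p)
... | nothing = ⊥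
Undercuts S w α _ = ⊥

_,_⊨_ : (S : Model) → Model.W S → Form → Set
S , w ⊨ atom p = Model.val S p w
S , w ⊨ neg φ = ¬ (S , w ⊨ φ)
S , w ⊨ and φ ψ = (S , w ⊨ φ) × (S , w ⊨ ψ)
S , w ⊨ box φ = ∀ v → Model.Rel S w v → S , v ⊨ φ
S , w ⊨ aware α = Model.O S w α
S , w ⊨ conc= α φ = Conc α ≡ φ
S , w ⊨ strictF α = ∀ R → ¬ InDefRule R α
S , w ⊨ undercuts α β = Undercuts S w α β
S , w ⊨ wellshap α = WS S w α

Sub : (S : Model) → Model.W S → Model
Sub S w = record
  { W   = Σ W (λ v → Star Rel w v)
  ; w₀  = (w , Star.ε)
  ; Rel = λ u v → Rel (Σ.proj₁ u) (Σ.proj₁ v)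
  ; O   = λ u → O (Σ.proj₁ u)
  ; D   = λ u → D (Σ.proj₁ u)
  ; nm  = λ u → nm (Σ.proj₁ u)
  ; val = λ p u → val p (Σ.proj₁ u)
  }
  where open Model S

{-# OPTIONS --safe #-}
module Submission where

-- Every world of the generated submodel is reached from w by a finite R-path,
-- and O, D and 𝔫 are invariant along single R-steps, hence along paths: this
-- makes the submodel uniform. Truth is preserved because the submodel is closed
-- under R-successors (the □ case) and every other clause only looks at the
-- current world, whose O, D, 𝔫 and valuation the submodel inherits unchanged.

open import Defs
open import Data.Product using (_×_; _,_; proj₁)
open import Data.Product.Function.NonDependent.Propositional using (_×-⇔_)
open import Data.List.Relation.Unary.All using (All; []; _∷_)
open import Data.Maybe using (just; nothing)
open import Function.Base using (id)
open import Function.Bundles using (_⇔_; mk⇔; Equivalence)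
import Function.Properties.Equivalence as ⇔
open import Function.Related.TypeIsomorphisms using (¬-cong-⇔)
open import Relation.Binary.Construct.Closure.ReflexiveTransitive
  using (Star; ε; _◅_; _◅◅_; fold)
open import Relation.Binary.PropositionalEquality using (_≡_; refl; sym) renaming (trans to ≡-trans)

≐-refl : {A : Set} {P : A → Set} → P ≐ P
≐-refl a = ⇔.refl

≐-sym : {A : Set} {P Q : A → Set} → P ≐ Q → Q ≐ P
≐-sym P≐Q a = ⇔.sym (P≐Q a)

≐-trans : {A : Set} {P Q R : A → Set} → P ≐ Q → Q ≐ R → P ≐ R
≐-trans P≐Q Q≐R a = ⇔.trans (P≐Q a) (Q≐R a)

module _ {S T : Model} {w : Model.W S} {u : Model.W T} where
  open Model

  mutual
    WS-transfer : (∀ R → D S w R → D T u R) → ∀ {α} → WS S w α → WS T u α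
    WS-transfer D⊆ (ws-leaf φ)            = ws-leaf φ
    WS-transfer D⊆ (ws-sarg α αs φ ws ⊢φ) = ws-sarg α αs φ (All-WS-transfer D⊆ ws) ⊢φ
    WS-transfer D⊆ (ws-darg α αs φ ws d)  = ws-darg α αs φ (All-WS-transfer D⊆ ws) (D⊆ _ d)

    All-WS-transfer : (∀ R → D S w R → D T u R) → ∀ {αs} → All (WS S w) αs → All (WS T u) αs
    All-WS-transfer D⊆ []         = []
    All-WS-transfer D⊆ (ws ∷ wss) = WS-transfer D⊆ ws ∷ All-WS-transfer D⊆ wss

  Undercuts-transfer : (∀ R → nm S w R ≡ nm T u R)
                     → ∀ α β → Undercuts S w α β → Undercuts T u α β
  Undercuts-transfer nm≡ α (darg β βs φ)
    with nm S w (TopRule β βs φ) | nm T u (TopRule β βs φ) | nm≡ (TopRule β βs φ)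
  ... | just p  | just .p  | refl = id
  ... | nothing | nothing  | refl = id

module GeneratedSubmodel (S : Model) (w : Model.W S) where
  open Model S

  Sᵂ : Model
  Sᵂ = Sub S w

  step : (u : Model.W Sᵂ) {v : W} → Rel (proj₁ u) v → Model.W Sᵂ
  step (u , w→u) {v} u→v = v , w→u ◅◅ (u→v ◅ ε)

  WS-Sub-⇔ : ∀ u α → WS S (proj₁ u) α ⇔ WS Sᵂ u α
  WS-Sub-⇔ u α = mk⇔ (WS-transfer (λ R → id)) (WS-transfer (λ R → id))

  Undercuts-Sub-⇔ : ∀ u α β → Undercuts S (proj₁ u) α β ⇔ Undercuts Sᵂ u α β
  Undercuts-Sub-⇔ u α β =
    mk⇔ (Undercuts-transfer (λ R → refl) α β) (Undercuts-transfer (λ R → refl) α β)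

  ⊨-Sub-⇔ : ∀ u φ → (S , proj₁ u ⊨ φ) ⇔ (Sᵂ , u ⊨ φ)
  ⊨-Sub-⇔ u (atom p)        = ⇔.refl
  ⊨-Sub-⇔ u (neg φ)         = ¬-cong-⇔ (⊨-Sub-⇔ u φ)
  ⊨-Sub-⇔ u (and φ ψ)       = ⊨-Sub-⇔ u φ ×-⇔ ⊨-Sub-⇔ u ψ
  ⊨-Sub-⇔ u (box φ)         = mk⇔
    (λ □φ v u→v → Equivalence.to (⊨-Sub-⇔ v φ) (□φ (proj₁ v) u→v))
    (λ □φ v u→v → Equivalence.from (⊨-Sub-⇔ (step u u→v) φ) (□φ (step u u→v) u→v))
  ⊨-Sub-⇔ u (aware α)       = ⇔.refl
  ⊨-Sub-⇔ u (conc= α φ)     = ⇔.refl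
  ⊨-Sub-⇔ u (strictF α)     = ⇔.refl
  ⊨-Sub-⇔ u (undercuts α β) = Undercuts-Sub-⇔ u α β
  ⊨-Sub-⇔ u (wellshap α)    = WS-Sub-⇔ u α

  module _ (K : IsKripke S) where
    open IsKripke K

    O-path : ∀ {u v} → Star Rel u v → O u ≐ O v
    O-path = fold (λ u v → O u ≐ O v) (λ u→v → ≐-trans (O-inv u→v)) ≐-refl

    D-path : ∀ {u v} → Star Rel u v → D u ≐ D v
    D-path = fold (λ u v → D u ≐ D v) (λ u→v → ≐-trans (D-inv u→v)) ≐-refl

    nm-path : ∀ {u v} → Star Rel u v → ∀ R → nm u R ≡ nm v R
    nm-path = fold (λ u v → ∀ R → nm u R ≡ nm v R)
                   (λ u→v eq R → ≡-trans (n-inv u→v R) (eq R)) (λ R → refl)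

    Sub-isKripke : IsKripke Sᵂ
    Sub-isKripke = record
      { serial   = λ u → let (v , u→v) = serial (proj₁ u) in step u u→v , u→v
      ; trans    = trans
      ; eucl     = eucl
      ; O-inv    = O-inv
      ; D-inv    = D-inv
      ; n-inv    = n-inv
      ; D-cons   = λ u → D-cons (proj₁ u)
      ; D-nonded = λ u → D-nonded (proj₁ u)
      }

    Sub-uniform : Uniform Sᵂ
    Sub-uniform = record
      { O-unif = λ (_ , w→u) (_ , w→u′) → ≐-trans (≐-sym (O-path w→u)) (O-path w→u′)
      ; D-unif = λ (_ , w→u) (_ , w→u′) → ≐-trans (≐-sym (D-path w→u)) (D-path w→u′)
      ; n-unif = λ (_ , w→u) (_ , w→u′) R _ → ≡-trans (sym (nm-path w→u R)) (nm-path w→u′ R)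
      }

lemma1 : (S : Model) → IsKripke S → (w : Model.W S)
    → (IsKripke (Sub S w) × Uniform (Sub S w))
    × (∀ φ → (S , w ⊨ φ) ⇔ (Sub S w , (w , Star.ε) ⊨ φ))
lemma1 S K w = (Sub-isKripke K , Sub-uniform K) , ⊨-Sub-⇔ (w , ε)
  where open GeneratedSubmodel S w
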